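{- Let $n\ge 1$ and let $A_n$ be the one-dimensional Clobber configuration consisting of $n$ stones on $n$ consecutive squares of a single row, with colors alternating black, white, black, white, $\dots$ (starting with a black stone). Then $A_n$ can be reduced to $\lceil n/4\rceil + [n\equiv 3 \pmod 4]$ stones by an alternating sequence of moves, no matter which color moves first. Here $[P]$ equals $1$ if $P$ holds and $0$ otherwise.
   Context: Clobber is played with black and white stones occupying some squares of a grid board. A move consists of picking up a stone and moving it onto a horizontally or vertically adjacent square occupied by a stone of the opposite color; that opposite-colored stone is removed ("clobbered") and replaced by the moved stone. In Solitaire Clobber, one performs an alternating sequence of moves, i.e., moves of white stones and moves of black stones alternate. A configuration is said to be reduced to $k$ stones if the sequence of moves ends in a configuration with exactly $k$ stones, none of which can move (no stone is horizontally or vertically adjacent to a stone of the opposite color). -}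

module Defs where

open import Data.Nat using (ℕ; zero; suc; _+_)
open import Data.Nat.DivMod using (_/_; _%_)
open import Data.Nat using (_≡ᵇ_)
open import Data.Bool using (Bool; true; false; if_then_else_)
open import Data.List using (List; []; _∷_)
open import Data.Maybe using (Maybe; just; nothing)
open import Relation.Nullary using (¬_)
open import Relation.Binary.PropositionalEquality using (_≡_)

data Colour : Set where
  black white : Colour

opp : Colour → Colour
opp black = white
opp white = black

-- A one-dimensional configuration: the squares of a single row, left to
-- right; each square is empty (nothing) or holds a stone (just c).
Config : Set
Config = List (Maybe Colour)

data Move (c : Colour) : Config → Config → Set where
  right : ∀ xs → Move c (just c ∷ just (opp c) ∷ xs) (nothing ∷ just c ∷ xs)
  left  : ∀ xs → Move c (just (opp c) ∷ just c ∷ xs) (just c ∷ nothing ∷ xs)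
  there : ∀ {xs ys} x → Move c xs ys → Move c (x ∷ xs) (x ∷ ys)

Stuck : Config → Set
Stuck x = ∀ c y → ¬ Move c x y

stones : Config → ℕ
stones [] = 0
stones (just _ ∷ xs) = suc (stones xs)
stones (nothing ∷ xs) = stones xs

data ReducesTo : Colour → Config → ℕ → Set where
  done : ∀ {c x k} → Stuck x → stones x ≡ k → ReducesTo c x k
  step : ∀ {c x y k} → Move c x y → ReducesTo (opp c) y k → ReducesTo c x k

alt : Colour → ℕ → Config
alt c zero = []
alt c (suc n) = just c ∷ alt (opp c) n

A : ℕ → Config
A n = alt black n

target : ℕ → ℕ
target n = (n + 3) / 4 + (if (n % 4) ≡ᵇ 3 then 1 else 0)

-- Three alternating moves, with either colour first, turn the leading block
-- B W B W of A (4 + m) into a single stone walled off by empty squares, and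
-- leave the other colour to move on the remaining copy of A m.  Such a wall
-- lets every move and every stuck position of the rest be lifted unchanged,
-- so target (4 + m) = 1 + target m is achieved by induction; A 0, …, A 3 are
-- reduced by at most one move.
module Submission where

open import Defs
open import Data.Nat using (ℕ; _≥_; suc; _+_; s≤s; z≤n)
open import Data.Nat.DivMod using (m/n≡1+[m∸n]/n)
open import Data.List using ([]; _∷_)
open import Data.Maybe using (just; nothing)
open import Relation.Binary.PropositionalEquality using (_≡_; refl; cong; sym; subst)

stuck-[] : Stuck []
stuck-[] c y ()

stuck-singleton : ∀ {a} → Stuck (just a ∷ [])
stuck-singleton c y (there _ ())

stuck-black-black : Stuck (just black ∷ just black ∷ [])
stuck-black-black c y (there _ (there _ ()))

stuck-nothing∷ : ∀ {xs} → Stuck xs → Stuck (nothing ∷ xs)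
stuck-nothing∷ st c y (there _ m) = st c _ m

stuck-isolated∷ : ∀ {a xs} → Stuck xs → Stuck (just a ∷ nothing ∷ xs)
stuck-isolated∷ st c y (there _ m) = stuck-nothing∷ st c _ m

reducesTo-nothing∷ : ∀ {c xs k} → ReducesTo c xs k → ReducesTo c (nothing ∷ xs) k
reducesTo-nothing∷ (done st k≡) = done (stuck-nothing∷ st) k≡
reducesTo-nothing∷ (step m r)   = step (there _ m) (reducesTo-nothing∷ r)

reducesTo-isolated∷ : ∀ {a c xs k} → ReducesTo c xs k → ReducesTo c (just a ∷ nothing ∷ xs) (suc k)
reducesTo-isolated∷ (done st k≡) = done (stuck-isolated∷ st) (cong suc k≡)
reducesTo-isolated∷ (step m r)   = step (there _ (there _ m)) (reducesTo-isolated∷ r)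

-- black: B W B W → · B B W → · B W · → · · B ·
-- white: B W B W → B W W · → · B W · → · W · ·
reducesTo-block : ∀ c {xs k} → ReducesTo (opp c) xs k →
                  ReducesTo c (just black ∷ just white ∷ just black ∷ just white ∷ xs) (suc k)
reducesTo-block black r =
  step (right _) (step (there _ (there _ (left _))) (step (there _ (right _))
    (reducesTo-nothing∷ (reducesTo-nothing∷ (reducesTo-isolated∷ r)))))
reducesTo-block white r =
  step (there _ (there _ (left _))) (step (right _) (step (there _ (left _))
    (reducesTo-nothing∷ (reducesTo-isolated∷ (reducesTo-nothing∷ r)))))

target-4+ : ∀ m → target (4 + m) ≡ suc (target m)
target-4+ m rewrite m/n≡1+[m∸n]/n {4 + (m + 3)} {4} (s≤s (s≤s (s≤s (s≤s z≤n)))) = refl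

A-reducesTo-target : ∀ n c → ReducesTo c (A n) (target n)
A-reducesTo-target 0 c = done stuck-[] refl
A-reducesTo-target 1 c = done stuck-singleton refl
A-reducesTo-target 2 black = step (right []) (reducesTo-nothing∷ (done stuck-singleton refl))
A-reducesTo-target 2 white = step (left []) (reducesTo-isolated∷ (done stuck-[] refl))
A-reducesTo-target 3 black = step (right _) (reducesTo-nothing∷ (done stuck-black-black refl))
A-reducesTo-target 3 white = step (left _) (reducesTo-isolated∷ (done stuck-singleton refl))
A-reducesTo-target (suc (suc (suc (suc m)))) c =
  subst (ReducesTo c (A (4 + m))) (sym (target-4+ m))
        (reducesTo-block c (A-reducesTo-target m (opp c)))

theorem1 : (n : ℕ) → n ≥ 1 → (c : Colour) → ReducesTo c (A n) (target n)
theorem1 n _ c = A-reducesTo-target n c
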